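{- A finite poset is a $\{B,C\}$-order if and only if it is a unit interval order.
   Context: Interval types: every interval $I_v$ has left endpoint $L(v)$, right endpoint $R(v)$, center $c(v)=(L(v)+R(v))/2$, and one of four types: $A$ (endpoints closed, center closed), $B$ (endpoints open, center open), $C$ (endpoints closed, center open), $D$ (endpoints open, center closed); the center always belongs to the interval. For nonempty $S\subseteq\{A,B,C,D\}$, an $S$-representation of a poset $(X,\prec)$ assigns to each $x\in X$ an interval $I_x$, all of the same positive length, each of type in $S$, such that $x\prec y$ iff (i) $R(x)<c(y)$, or (ii) $R(x)=c(y)$, at least one of $R(x),c(y)$ is open, and at least one of $L(y),c(x)$ is open. An $S$-order is a poset with an $S$-representation. A unit interval order is a poset representable by real intervals of equal length with $x\prec y$ iff every point of $I_x$ is less than every point of $I_y$.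
   Formalization: The interval endpoints and common lengths of both kinds of representation, and the points compared in the unit interval order, range over ℚ rather than over the real numbers. -}

module Defs where

open import Data.Nat using (ℕ)
open import Data.Fin using (Fin)
open import Data.Bool using (Bool; true; false)
open import Data.Rational using (ℚ; 0ℚ; ½; _+_; _*_; _<_; _≤_)
open import Data.Product using (Σ; _×_; _,_)
open import Data.Sum using (_⊎_)
open import Relation.Binary.PropositionalEquality using (_≡_)
open import Relation.Binary.Structures using (IsStrictPartialOrder)
open import Function.Bundles using (_⇔_)

data IType : Set where
  A B C D : IType

endOpen : IType → Bool
endOpen A = false
endOpen B = true
endOpen C = false
endOpen D = true

cenOpen : IType → Bool
cenOpen A = false
cenOpen B = true
cenOpen C = true
cenOpen D = false

BC : IType → Set
BC t = t ≡ B ⊎ t ≡ C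

record SRep (S : IType → Set) (n : ℕ) (_≺_ : Fin n → Fin n → Set) : Set where
  field
    L    : Fin n → ℚ
    len  : ℚ
    typ  : Fin n → IType
    len-pos : 0ℚ < len
    typ-S   : ∀ x → S (typ x)
  R : Fin n → ℚ
  R x = L x + len
  c : Fin n → ℚ
  c x = L x + len * ½
  field
    rep : ∀ x y →
      (x ≺ y) ⇔
      (R x < c y
       ⊎ (R x ≡ c y
          × (endOpen (typ x) ≡ true ⊎ cenOpen (typ y) ≡ true)
          × (endOpen (typ y) ≡ true ⊎ cenOpen (typ x) ≡ true)))

SOrder : (S : IType → Set) (n : ℕ) (_≺_ : Fin n → Fin n → Set) → Set
SOrder S n _≺_ = SRep S n _≺_

record UIRep (n : ℕ) (_≺_ : Fin n → Fin n → Set) : Set where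
  field
    L   : Fin n → ℚ
    len : ℚ
    len-pos : 0ℚ < len
  R : Fin n → ℚ
  R x = L x + len
  field
    rep : ∀ x y →
      (x ≺ y) ⇔
      (∀ p q → L x ≤ p → p ≤ R x → L y ≤ q → q ≤ R y → p < q)

UnitIntervalOrder : (n : ℕ) (_≺_ : Fin n → Fin n → Set) → Set
UnitIntervalOrder n _≺_ = UIRep n _≺_

-- In a {B,C}-representation every centre is open, so x ≺ y holds exactly when
-- L(y) − L(x) ≥ len/2; in a unit interval representation it holds exactly when
-- L(y) − L(x) > len.  Only finitely many differences L(y) − L(x) occur, so a
-- closed threshold can be traded for an open one (and conversely) lying
-- strictly between two consecutive differences, keeping the left endpoints.
module Submission where

open import Defs
open import Data.Nat using (ℕ)
open import Data.Fin using (Fin)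
open import Relation.Binary.PropositionalEquality using (_≡_)
open import Relation.Binary.Structures using (IsStrictPartialOrder)
open import Function.Bundles using (_⇔_)

open import Data.Bool using (true)
open import Data.Rational using (ℚ; 0ℚ; 1ℚ; ½; _+_; _-_; -_; _*_; _<_; _≤_)
open import Data.Rational.Properties
open import Data.Rational.Solver using (module +-*-Solver)
open import Algebra.Properties.Group +-0-group using (//-rightDividesʳ)
open import Relation.Binary.Bundles using (DecTotalOrder)
open import Data.List using (List; allFin; filter; cartesianProductWith)
open import Data.List.Extrema (DecTotalOrder.totalOrder ≤-decTotalOrder)
  using (max; min; argmax-sel; argmin-sel; v≤max⁺; xs≤max; min≤xs)
open import Data.List.Membership.Propositional using (_∈_)
open import Data.List.Membership.Propositional.Properties
  using (∈-filter⁺; ∈-filter⁻; ∈-allFin; ∈-cartesianProductWith⁺)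
open import Data.List.Relation.Unary.All using (All; lookup; tabulate)
open import Data.Product using (∃-syntax; _×_; _,_; proj₂)
open import Data.Sum using (_⊎_; inj₁; inj₂)
open import Function.Base using (id)
open import Function.Bundles using (mk⇔)
open import Function.Construct.Composition using (_⇔-∘_)
open import Function.Construct.Symmetry using (⇔-sym)
open import Relation.Binary.PropositionalEquality using (refl; sym; subst; subst₂)
open import Relation.Nullary using (yes; no)

open +-*-Solver using (solve; _:+_; _:-_; _:*_; con; _:=_)

≤-translate : ∀ r {p q u v} → p + r ≡ u → q + r ≡ v → p ≤ q ⇔ u ≤ v
≤-translate r {p} {q} refl refl = mk⇔ (+-monoˡ-≤ r) λ p+r≤q+r →
  subst₂ _≤_ (//-rightDividesʳ r p) (//-rightDividesʳ r q) (+-monoˡ-≤ (- r) p+r≤q+r)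

<-translate : ∀ r {p q u v} → p + r ≡ u → q + r ≡ v → p < q ⇔ u < v
<-translate r {p} {q} refl refl = mk⇔ (+-monoˡ-< r) λ p+r<q+r →
  subst₂ _<_ (//-rightDividesʳ r p) (//-rightDividesʳ r q) (+-monoˡ-< (- r) p+r<q+r)

halfLength≤gap⇔ : ∀ a b len → len * ½ ≤ b - a ⇔ a + len ≤ b + len * ½
halfLength≤gap⇔ a b len = ≤-translate (a + len * ½)
  (solve 2 (λ a len → len :* con ½ :+ (a :+ len :* con ½) := a :+ len) refl a len)
  (solve 3 (λ a b len → (b :- a) :+ (a :+ len :* con ½) := b :+ len :* con ½) refl a b len)

length<gap⇔ : ∀ a b len → len < b - a ⇔ a + len < b
length<gap⇔ a b len = <-translate a (+-comm len a)
  (solve 2 (λ a b → (b :- a) :+ a := b) refl a b)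

double-half : ∀ h → (h + h) * ½ ≡ h
double-half = solve 1 (λ h → (h :+ h) :* con ½ := h) refl

-- Both cuts are found among the finitely many values: the open one strictly
-- between the largest value below h and h, the closed one at the smallest
-- value above h.
closedCut⇒openCut : ∀ {h} (ds : List ℚ) → 0ℚ < h →
                    ∃[ t ] 0ℚ < t × All (λ d → h ≤ d ⇔ t < d) ds
closedCut⇒openCut {h} ds 0<h =
  let t , m<t , t<h = <-dense m<h
  in t , ≤-<-trans 0≤m m<t , tabulate λ d∈ds → mk⇔ (<-≤-trans t<h) (cut d∈ds m<t)
  where
  below : List ℚ
  below = filter (_<? h) ds
  m : ℚ
  m = max 0ℚ below
  0≤m : 0ℚ ≤ m
  0≤m = v≤max⁺ 0ℚ below (inj₁ ≤-refl)
  m<h : m < h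
  m<h with argmax-sel id 0ℚ below
  ... | inj₁ m≡0 = subst (_< h) (sym m≡0) 0<h
  ... | inj₂ m∈below = proj₂ (∈-filter⁻ (_<? h) {xs = ds} m∈below)
  cut : ∀ {d t} → d ∈ ds → m < t → t < d → h ≤ d
  cut {d} d∈ds m<t t<d = ≮⇒≥ λ d<h →
    <-asym t<d (≤-<-trans (lookup (xs≤max 0ℚ below) (∈-filter⁺ (_<? h) d∈ds d<h)) m<t)

openCut⇒closedCut : ∀ (ds : List ℚ) h → ∃[ t ] h < t × All (λ d → h < d ⇔ t ≤ d) ds
openCut⇒closedCut ds h =
  t , h<t , tabulate λ d∈ds → mk⇔ (t≤d d∈ds) (<-≤-trans h<t)
  where
  above : List ℚ
  above = filter (h <?_) ds
  t : ℚ
  t = min (h + 1ℚ) above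
  h<h+1 : h < h + 1ℚ
  h<h+1 = subst (_< h + 1ℚ) (+-identityʳ h) (+-monoʳ-< h (positive⁻¹ 1ℚ))
  h<t : h < t
  h<t with argmin-sel id (h + 1ℚ) above
  ... | inj₁ t≡h+1 = subst (h <_) (sym t≡h+1) h<h+1
  ... | inj₂ t∈above = proj₂ (∈-filter⁻ (h <?_) {xs = ds} t∈above)
  t≤d : ∀ {d} → d ∈ ds → h < d → t ≤ d
  t≤d d∈ds h<d = lookup (min≤xs (h + 1ℚ) above) (∈-filter⁺ (h <?_) d∈ds h<d)

differences : ∀ {n} → (Fin n → ℚ) → List ℚ
differences {n} L = cartesianProductWith (λ x y → L y - L x) (allFin n) (allFin n)

∈-differences : ∀ {n} (L : Fin n → ℚ) x y → L y - L x ∈ differences L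
∈-differences L x y = ∈-cartesianProductWith⁺ (λ x y → L y - L x) (∈-allFin x) (∈-allFin y)

SPrecedes : IType → IType → ℚ → ℚ → Set
SPrecedes tx ty r c =
  r < c ⊎ (r ≡ c × (endOpen tx ≡ true ⊎ cenOpen ty ≡ true)
                 × (endOpen ty ≡ true ⊎ cenOpen tx ≡ true))

BC⇒cenOpen : ∀ {t} → BC t → cenOpen t ≡ true
BC⇒cenOpen (inj₁ refl) = refl
BC⇒cenOpen (inj₂ refl) = refl

BC-SPrecedes⇔≤ : ∀ {tx ty} → BC tx → BC ty → ∀ {r c} → SPrecedes tx ty r c ⇔ r ≤ c
BC-SPrecedes⇔≤ bx by {r} {c} = mk⇔ to from
  where
  to : SPrecedes _ _ r c → r ≤ c
  to (inj₁ r<c)           = <⇒≤ r<c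
  to (inj₂ (refl , _ , _)) = ≤-refl
  from : r ≤ c → SPrecedes _ _ r c
  from r≤c with r <? c
  ... | yes r<c = inj₁ r<c
  ... | no r≮c  = inj₂ (≤-antisym r≤c (≮⇒≥ r≮c) , inj₂ (BC⇒cenOpen by) , inj₂ (BC⇒cenOpen bx))

closedIntervals-precede⇔ : ∀ a b {len} → 0ℚ ≤ len →
  (∀ p q → a ≤ p → p ≤ a + len → b ≤ q → q ≤ b + len → p < q) ⇔ a + len < b
closedIntervals-precede⇔ a b {len} 0≤len = mk⇔
  (λ precede → precede (a + len) b (≤-extend a) ≤-refl ≤-refl (≤-extend b))
  (λ a+len<b p q _ p≤a+len b≤q _ → ≤-<-trans p≤a+len (<-≤-trans a+len<b b≤q))
  where
  ≤-extend : ∀ e → e ≤ e + len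
  ≤-extend e = subst (_≤ e + len) (+-identityʳ e) (+-monoʳ-≤ e 0≤len)

module _ {n : ℕ} {_≺_ : Fin n → Fin n → Set} where

  BCOrder-≺⇔ : (S : SOrder BC n _≺_) → let open SRep S in
               ∀ x y → x ≺ y ⇔ len * ½ ≤ L y - L x
  BCOrder-≺⇔ S x y =
    ⇔-sym (halfLength≤gap⇔ (L x) (L y) len) ⇔-∘ (BC-SPrecedes⇔≤ (typ-S x) (typ-S y) ⇔-∘ rep x y)
    where open SRep S

  UnitIntervalOrder-≺⇔ : (U : UnitIntervalOrder n _≺_) → let open UIRep U in
                         ∀ x y → x ≺ y ⇔ len < L y - L x
  UnitIntervalOrder-≺⇔ U x y =
    ⇔-sym (length<gap⇔ (L x) (L y) len)
      ⇔-∘ (closedIntervals-precede⇔ (L x) (L y) (<⇒≤ len-pos) ⇔-∘ rep x y)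
    where open UIRep U

  BCOrder-from : (L : Fin n → ℚ) {h : ℚ} → 0ℚ < h →
                 (∀ x y → x ≺ y ⇔ h ≤ L y - L x) → SOrder BC n _≺_
  BCOrder-from L {h} 0<h ≺⇔ = record
    { L = L ; len = h + h ; typ = λ _ → B
    ; len-pos = +-mono-< 0<h 0<h ; typ-S = λ _ → inj₁ refl
    ; rep = λ x y → ⇔-sym (BC-SPrecedes⇔≤ (inj₁ refl) (inj₁ refl))
                    ⇔-∘ (halfLength≤gap⇔ (L x) (L y) (h + h)
                    ⇔-∘ subst (λ k → x ≺ y ⇔ k ≤ L y - L x) (sym (double-half h)) (≺⇔ x y))
    }

  UnitIntervalOrder-from : (L : Fin n → ℚ) {len : ℚ} → 0ℚ < len →
                           (∀ x y → x ≺ y ⇔ len < L y - L x) → UnitIntervalOrder n _≺_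
  UnitIntervalOrder-from L {len} 0<len ≺⇔ = record
    { L = L ; len = len ; len-pos = 0<len
    ; rep = λ x y → ⇔-sym (closedIntervals-precede⇔ (L x) (L y) (<⇒≤ 0<len))
                    ⇔-∘ (length<gap⇔ (L x) (L y) len ⇔-∘ ≺⇔ x y)
    }

proposition11 : (n : ℕ) (_≺_ : Fin n → Fin n → Set) →
                IsStrictPartialOrder _≡_ _≺_ →
                SOrder BC n _≺_ ⇔ UnitIntervalOrder n _≺_
proposition11 n _≺_ _ = mk⇔ toUnitInterval toBC
  where
  toUnitInterval : SOrder BC n _≺_ → UnitIntervalOrder n _≺_
  toUnitInterval S =
    let open SRep S
        t , 0<t , cut = closedCut⇒openCut (differences L) (*-monoˡ-<-pos ½ len-pos)
    in UnitIntervalOrder-from L 0<t λ x y →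
         lookup cut (∈-differences L x y) ⇔-∘ BCOrder-≺⇔ S x y

  toBC : UnitIntervalOrder n _≺_ → SOrder BC n _≺_
  toBC U =
    let open UIRep U
        t , len<t , cut = openCut⇒closedCut (differences L) len
    in BCOrder-from L (<-trans len-pos len<t) λ x y →
         lookup cut (∈-differences L x y) ⇔-∘ UnitIntervalOrder-≺⇔ U x y
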